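{- The Cartesian product $G\square H$ of two graphs is not a minimal counterexample to the conjecture that $\chi(G)\le \mathrm{toi}(G)$ for every graph $G$.
   Context: $\mathrm{toi}(G)$ is the maximum $t$ such that $G$ contains a totally odd strong immersion of $K_t$ (pairwise edge-disjoint odd paths joining all pairs of $t$ terminal vertices, with no terminal appearing as an interior vertex of a path), and $\chi(G)$ is the chromatic number. The conjecture (of Jiménez, Quiroz and Thraves Caro) states $\chi(G)\le\mathrm{toi}(G)$ for every graph $G$. $G\square H$ denotes the Cartesian product: vertex set $V(G)\times V(H)$, with $(g_1,h_1)(g_2,h_2)$ an edge if $g_1=g_2$ and $h_1h_2\in E(H)$, or $h_1=h_2$ and $g_1g_2\in E(G)$. -}

module Defs where

open import Data.Nat using (ℕ; zero; suc; _*_)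
open import Data.Fin using (Fin; remQuot) renaming (_<_ to _<ᶠ_)
open import Data.List using (List; []; _∷_; length)
open import Data.List.Membership.Propositional using (_∈_)
open import Data.List.Relation.Unary.Unique.Propositional using (Unique)
open import Data.Product using (Σ; ∃; _×_; _,_; proj₁; proj₂)
open import Data.Sum using (_⊎_; inj₁; inj₂)
open import Data.Unit using (⊤)
open import Data.Empty using (⊥)
open import Relation.Nullary using (¬_)
open import Relation.Binary.PropositionalEquality using (_≡_; _≢_; refl; sym)
open import Function.Definitions using (Injective)

record Graph : Set₁ where
  field
    n     : ℕ
    E     : Fin n → Fin n → Set
    E-sym : ∀ {u v} → E u v → E v u
    E-irr : ∀ {u} → ¬ E u u
open Graph public

-- Cartesian product G □ H: vertex x of Fin (n G * n H) encodes the pair remQuot (n H) x.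
prodAdj : (G H : Graph) → Fin (n G) × Fin (n H) → Fin (n G) × Fin (n H) → Set
prodAdj G H (g₁ , h₁) (g₂ , h₂) = (g₁ ≡ g₂ × E H h₁ h₂) ⊎ (h₁ ≡ h₂ × E G g₁ g₂)

prodAdj-sym : (G H : Graph) → ∀ {a b} → prodAdj G H a b → prodAdj G H b a
prodAdj-sym G H (inj₁ (p , e)) = inj₁ (sym p , E-sym H e)
prodAdj-sym G H (inj₂ (p , e)) = inj₂ (sym p , E-sym G e)

prodAdj-irr : (G H : Graph) → ∀ {a} → ¬ prodAdj G H a a
prodAdj-irr G H (inj₁ (_ , e)) = E-irr H e
prodAdj-irr G H (inj₂ (_ , e)) = E-irr G e

_□_ : Graph → Graph → Graph
G □ H = record
  { n     = n G * n H
  ; E     = λ x y → prodAdj G H (remQuot (n H) x) (remQuot (n H) y)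
  ; E-sym = prodAdj-sym G H
  ; E-irr = prodAdj-irr G H
  }

Colorable : Graph → ℕ → Set
Colorable G k = Σ (Fin (n G) → Fin k) λ c → ∀ u v → E G u v → c u ≢ c v

Odd : ℕ → Set
Odd m = ∃ λ k → m ≡ suc (2 * k)

Chain : (G : Graph) → List (Fin (n G)) → Set
Chain G []            = ⊤
Chain G (x ∷ [])      = ⊤
Chain G (x ∷ y ∷ xs)  = E G x y × Chain G (y ∷ xs)

edgesOf : {A : Set} → List A → List (A × A)
edgesOf []           = []
edgesOf (x ∷ [])     = []
edgesOf (x ∷ y ∷ xs) = (x , y) ∷ edgesOf (y ∷ xs)

lastOr : {A : Set} → A → List A → A
lastOr a []       = a
lastOr a (x ∷ xs) = lastOr x xs

SameEdge : {A : Set} → A × A → A × A → Set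
SameEdge (a , b) (c , d) = (a ≡ c × b ≡ d) ⊎ (a ≡ d × b ≡ c)

record Path (G : Graph) (u v : Fin (n G)) : Set where
  field
    rest  : List (Fin (n G))
    chain : Chain G (u ∷ rest)
    uniq  : Unique (u ∷ rest)
    ends  : lastOr u rest ≡ v
open Path public

verts : {G : Graph} {u v : Fin (n G)} → Path G u v → List (Fin (n G))
verts {u = u} P = u ∷ rest P

pathLength : {G : Graph} {u v : Fin (n G)} → Path G u v → ℕ
pathLength P = length (rest P)

EdgeDisjoint : {G : Graph} {a b c d : Fin (n G)} → Path G a b → Path G c d → Set
EdgeDisjoint P Q = ∀ e f → e ∈ edgesOf (verts P) → f ∈ edgesOf (verts Q) → ¬ SameEdge e f

-- Totally odd strong immersion of K_t in G.
record TOImmersion (G : Graph) (t : ℕ) : Set where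
  field
    τ       : Fin t → Fin (n G)
    τ-inj   : Injective _≡_ _≡_ τ
    path    : (i j : Fin t) → i <ᶠ j → Path G (τ i) (τ j)
    odd     : ∀ i j (p : i <ᶠ j) → Odd (pathLength (path i j p))
    disjoint : ∀ i j k l (p : i <ᶠ j) (q : k <ᶠ l) → (i ≢ k ⊎ j ≢ l) →
               EdgeDisjoint (path i j p) (path k l q)
    strong  : ∀ i j (p : i <ᶠ j) (s : Fin t) → τ s ∈ verts (path i j p) →
              (τ s ≡ τ i) ⊎ (τ s ≡ τ j)

-- χ(G) ≤ toi(G), unfolded: some t admits both a totally odd immersion of K_t
-- and a proper t-colouring.
SatisfiesConj : Graph → Set
SatisfiesConj G = Σ ℕ λ t → TOImmersion G t × Colorable G t

Counterexample : Graph → Set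
Counterexample G = ¬ SatisfiesConj G

ProperSubgraph : Graph → Graph → Set
ProperSubgraph H G =
  Σ (Fin (n H) → Fin (n G)) λ f →
    Injective _≡_ _≡_ f ×
    (∀ u v → E H u v → E G (f u) (f v)) ×
    ((Σ (Fin (n G)) λ w → ∀ u → f u ≢ w) ⊎
     (Σ (Fin (n H)) λ u → Σ (Fin (n H)) λ v → E G (f u) (f v) × ¬ E H u v))

MinimalCounterexample : Graph → Set₁
MinimalCounterexample G = Counterexample G × (∀ H → ProperSubgraph H G → SatisfiesConj H)

{-# OPTIONS --safe #-}
module Submission where

-- The fibres G × {h} and {g} × H are proper subgraphs of G □ H, so by minimality
-- G and H satisfy the conjecture with some s and t, say s ≤ t.  An injective
-- homomorphism carries a totally odd immersion of K_t in H to one in G □ H, and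
-- (g , h) ↦ c(g) + d(h) mod t is a proper t-colouring of G □ H, because adjacent
-- vertices agree in one coordinate and have distinct colours in the other.

open import Defs
open import Data.Nat using (_≤_)
open import Relation.Nullary using (¬_)

open import Data.Nat as ℕ using (suc; _+_; _∸_; _%_; s≤s)
open import Data.Nat.Properties using (+-comm; +-assoc; ≤-total; m∸n+n≡m; <⇒≤)
open import Data.Nat.DivMod
  using (_mod_; m%n<n; %-distribˡ-+; m%n%n≡m%n; [m+n]%n≡m%n; m<n⇒m%n≡m)
open import Data.Fin as Fin using (Fin; toℕ; combine; remQuot; inject≤)
open import Data.Fin.Properties
  using (toℕ<n; toℕ-fromℕ<; toℕ-injective; remQuot-combine;
         combine-injectiveˡ; combine-injectiveʳ; inject≤-injective)
open import Data.List using ([]; _∷_; map)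
open import Data.List.Properties using (length-map)
open import Data.List.Membership.Propositional using (_∈_)
open import Data.List.Membership.Propositional.Properties using (∈-map⁻)
import Data.List.Relation.Unary.Unique.Propositional.Properties as Unique
open import Data.Product as Product using (Σ; _×_; _,_)
open import Data.Sum as Sum using (inj₁; inj₂)
open import Data.Unit using (tt)
open import Relation.Binary.PropositionalEquality
open import Function.Definitions using (Injective)

record Embedding (A B : Graph) : Set where
  field
    vertex    : Fin (n A) → Fin (n B)
    injective : Injective _≡_ _≡_ vertex
    edge      : ∀ u v → E A u v → E B (vertex u) (vertex v)

module _ {A B : Graph} (φ : Embedding A B) where
  open Embedding φ

  chain-map : ∀ xs → Chain A xs → Chain B (map vertex xs)
  chain-map []           _       = tt
  chain-map (x ∷ [])     _       = tt
  chain-map (x ∷ y ∷ xs) (e , c) = edge x y e , chain-map (y ∷ xs) c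

  lastOr-map : ∀ u xs → lastOr (vertex u) (map vertex xs) ≡ vertex (lastOr u xs)
  lastOr-map u []       = refl
  lastOr-map u (x ∷ xs) = lastOr-map x xs

  edgesOf-map : ∀ xs → edgesOf (map vertex xs) ≡ map (Product.map vertex vertex) (edgesOf xs)
  edgesOf-map []           = refl
  edgesOf-map (x ∷ [])     = refl
  edgesOf-map (x ∷ y ∷ xs) = cong ((vertex x , vertex y) ∷_) (edgesOf-map (y ∷ xs))

  path-map : ∀ {u v} → Path A u v → Path B (vertex u) (vertex v)
  path-map {u} P = record
    { rest  = map vertex (rest P)
    ; chain = chain-map (u ∷ rest P) (chain P)
    ; uniq  = Unique.map⁺ injective (uniq P)
    ; ends  = trans (lastOr-map u (rest P)) (cong vertex (ends P))
    }

  ∈-verts-path-map⁻ : ∀ {u v x} (P : Path A u v) → vertex x ∈ verts (path-map P) → x ∈ verts P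
  ∈-verts-path-map⁻ P x∈ with ∈-map⁻ vertex {xs = verts P} x∈
  ... | _ , y∈ , x≡y rewrite injective x≡y = y∈

  sameEdge-reflect : ∀ e f →
    SameEdge (Product.map vertex vertex e) (Product.map vertex vertex f) → SameEdge e f
  sameEdge-reflect _ _ (inj₁ (p , q)) = inj₁ (injective p , injective q)
  sameEdge-reflect _ _ (inj₂ (p , q)) = inj₂ (injective p , injective q)

  edgeDisjoint-map : ∀ {a b c d} (P : Path A a b) (Q : Path A c d) →
                     EdgeDisjoint P Q → EdgeDisjoint (path-map P) (path-map Q)
  edgeDisjoint-map {a} {c = c} P Q P#Q e f e∈ f∈ same
    rewrite edgesOf-map (a ∷ rest P) | edgesOf-map (c ∷ rest Q)
    with ∈-map⁻ (Product.map vertex vertex) e∈ | ∈-map⁻ (Product.map vertex vertex) f∈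
  ... | e′ , e′∈ , refl | f′ , f′∈ , refl = P#Q e′ f′ e′∈ f′∈ (sameEdge-reflect e′ f′ same)

  TOImmersion-map : ∀ {t} → TOImmersion A t → TOImmersion B t
  TOImmersion-map I = record
    { τ        = λ i → vertex (τ i)
    ; τ-inj    = λ eq → τ-inj (injective eq)
    ; path     = λ i j i<j → path-map (path i j i<j)
    ; odd      = λ i j i<j →
        subst Odd (sym (length-map vertex (rest (path i j i<j)))) (odd i j i<j)
    ; disjoint = λ i j k l i<j k<l ij≢kl → edgeDisjoint-map (path i j i<j) (path k l k<l)
                                               (disjoint i j k l i<j k<l ij≢kl)
    ; strong   = λ i j i<j s τs∈ →
        Sum.map (cong vertex) (cong vertex)
          (strong i j i<j s (∈-verts-path-map⁻ (path i j i<j) τs∈))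
    }
    where open TOImmersion I

[m+n%d]%d≡[m+n]%d : ∀ m n d .{{_ : ℕ.NonZero d}} → (m + n % d) % d ≡ (m + n) % d
[m+n%d]%d≡[m+n]%d m n d = begin
  (m + n % d) % d          ≡⟨ %-distribˡ-+ m (n % d) d ⟩
  (m % d + n % d % d) % d  ≡⟨ cong (λ r → (m % d + r) % d) (m%n%n≡m%n n d) ⟩
  (m % d + n % d) % d      ≡⟨ %-distribˡ-+ m n d ⟨
  (m + n) % d              ∎
  where open ≡-Reasoning

+-cancelˡ-% : ∀ {a b c t} .{{_ : ℕ.NonZero t}} → a ≤ t → b ℕ.< t → c ℕ.< t →
              (a + b) % t ≡ (a + c) % t → b ≡ c
+-cancelˡ-% {a} {b} {c} {t} a≤t b<t c<t eq = begin
  b                          ≡⟨ undo b<t ⟨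
  (t ∸ a + (a + b) % t) % t  ≡⟨ cong (λ r → (t ∸ a + r) % t) eq ⟩
  (t ∸ a + (a + c) % t) % t  ≡⟨ undo c<t ⟩
  c                          ∎
  where
  open ≡-Reasoning
  undo : ∀ {x} → x ℕ.< t → (t ∸ a + (a + x) % t) % t ≡ x
  undo {x} x<t = begin
    (t ∸ a + (a + x) % t) % t  ≡⟨ [m+n%d]%d≡[m+n]%d (t ∸ a) (a + x) t ⟩
    (t ∸ a + (a + x)) % t      ≡⟨ cong (_% t) (+-assoc (t ∸ a) a x) ⟨
    (t ∸ a + a + x) % t        ≡⟨ cong (λ m → (m + x) % t) (m∸n+n≡m a≤t) ⟩
    (t + x) % t                ≡⟨ cong (_% t) (+-comm t x) ⟩
    (x + t) % t                ≡⟨ [m+n]%n≡m%n x t ⟩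
    x % t                      ≡⟨ m<n⇒m%n≡m x<t ⟩
    x                          ∎

_⊕_ : ∀ {t} → Fin t → Fin t → Fin t
_⊕_ {suc t} i j = (toℕ i + toℕ j) mod suc t

⊕-comm : ∀ {t} (i j : Fin t) → i ⊕ j ≡ j ⊕ i
⊕-comm {suc t} i j = cong (_mod suc t) (+-comm (toℕ i) (toℕ j))

⊕-cancelˡ : ∀ {t} (i : Fin t) {j k} → i ⊕ j ≡ i ⊕ k → j ≡ k
⊕-cancelˡ {suc t} i {j} {k} eq = toℕ-injective
  (+-cancelˡ-% (<⇒≤ (toℕ<n i)) (toℕ<n j) (toℕ<n k) (begin
    (toℕ i + toℕ j) % suc t  ≡⟨ toℕ-fromℕ< (m%n<n (toℕ i + toℕ j) (suc t)) ⟨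
    toℕ (i ⊕ j)              ≡⟨ cong toℕ eq ⟩
    toℕ (i ⊕ k)              ≡⟨ toℕ-fromℕ< (m%n<n (toℕ i + toℕ k) (suc t)) ⟩
    (toℕ i + toℕ k) % suc t  ∎))
  where open ≡-Reasoning

⊕-cancelʳ : ∀ {t} (i : Fin t) {j k} → j ⊕ i ≡ k ⊕ i → j ≡ k
⊕-cancelʳ i {j} {k} eq = ⊕-cancelˡ i (trans (⊕-comm i j) (trans eq (⊕-comm k i)))

colorable-mono : ∀ G {s t} → s ≤ t → Colorable G s → Colorable G t
colorable-mono G s≤t (c , proper) =
  (λ v → inject≤ (c v) s≤t) ,
  λ u v uv eq → proper u v uv (inject≤-injective s≤t s≤t (c u) (c v) eq)

□-colorable : ∀ G H {t} → Colorable G t → Colorable H t → Colorable (G □ H) t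
□-colorable G H {t} (c , c-proper) (d , d-proper) =
  (λ x → colour (remQuot (n H) x)) , λ x y → proper (remQuot (n H) x) (remQuot (n H) y)
  where
  colour : Fin (n G) × Fin (n H) → Fin t
  colour (g , h) = c g ⊕ d h

  proper : ∀ x y → prodAdj G H x y → colour x ≢ colour y
  proper (g , h) (_ , h′) (inj₁ (refl , hh′)) eq = d-proper h h′ hh′ (⊕-cancelˡ (c g) eq)
  proper (g , h) (g′ , _) (inj₂ (refl , gg′)) eq = c-proper g g′ gg′ (⊕-cancelʳ (d h) eq)

embedding⇒properSubgraph : ∀ {A B} (φ : Embedding A B) (w : Fin (n B)) →
                           (∀ u → Embedding.vertex φ u ≢ w) → ProperSubgraph A B
embedding⇒properSubgraph φ w w∉φ = vertex , injective , edge , inj₁ (w , w∉φ)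
  where open Embedding φ

module _ (G H : Graph) where

  □-edge : ∀ {g g′ h h′} → prodAdj G H (g , h) (g′ , h′) →
           E (G □ H) (combine g h) (combine g′ h′)
  □-edge {g} {g′} {h} {h′} =
    subst₂ (prodAdj G H) (sym (remQuot-combine g h)) (sym (remQuot-combine g′ h′))

  □-embedˡ : Fin (n H) → Embedding G (G □ H)
  □-embedˡ h = record
    { vertex    = λ g → combine g h
    ; injective = λ {g} {g′} → combine-injectiveˡ g h g′ h
    ; edge      = λ g g′ gg′ → □-edge (inj₂ (refl , gg′))
    }

  □-embedʳ : Fin (n G) → Embedding H (G □ H)
  □-embedʳ g = record
    { vertex    = combine g
    ; injective = λ {h} {h′} → combine-injectiveʳ g h g h′
    ; edge      = λ h h′ hh′ → □-edge (inj₁ (refl , hh′))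
    }

  □-properSubgraphˡ : Fin (n G) → ∀ {h h′} → h ≢ h′ → ProperSubgraph G (G □ H)
  □-properSubgraphˡ g {h} {h′} h≢h′ = embedding⇒properSubgraph (□-embedˡ h) (combine g h′)
    λ g′ eq → h≢h′ (combine-injectiveʳ g′ h g h′ eq)

  □-properSubgraphʳ : Fin (n H) → ∀ {g g′} → g ≢ g′ → ProperSubgraph H (G □ H)
  □-properSubgraphʳ h {g} {g′} g≢g′ = embedding⇒properSubgraph (□-embedʳ g) (combine g′ h)
    λ h′ eq → g≢g′ (combine-injectiveˡ g h′ g′ h eq)

  □-satisfiesConj : Fin (n G) → Fin (n H) →
                    SatisfiesConj G → SatisfiesConj H → SatisfiesConj (G □ H)
  □-satisfiesConj g h (s , Iₛ , Cₛ) (t , Iₜ , Cₜ) with ≤-total s t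
  ... | inj₁ s≤t =
    t , TOImmersion-map (□-embedʳ g) Iₜ , □-colorable G H (colorable-mono G s≤t Cₛ) Cₜ
  ... | inj₂ t≤s =
    s , TOImmersion-map (□-embedˡ h) Iₛ , □-colorable G H Cₛ (colorable-mono H t≤s Cₜ)

distinct-pair : ∀ {m} → 2 ≤ m → Σ (Fin m) λ i → Σ (Fin m) λ j → i ≢ j
distinct-pair (s≤s (s≤s _)) = Fin.zero , Fin.suc Fin.zero , λ ()

corollary14 : (G H : Graph) → 2 ≤ n G → 2 ≤ n H → ¬ MinimalCounterexample (G □ H)
corollary14 G H 2≤|G| 2≤|H| (counterexample , minimal)
  with g , g′ , g≢g′ ← distinct-pair 2≤|G|
     | h , h′ , h≢h′ ← distinct-pair 2≤|H|
  = counterexample (□-satisfiesConj G H g h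
      (minimal G (□-properSubgraphˡ G H g h≢h′))
      (minimal H (□-properSubgraphʳ G H h g≢g′)))
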